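{- Let $p\in\mathrm{MVP}_n$, let $\pi=\mathcal{O}_{\mathrm{MVP}_n}(p)$ and let $S=\{(j,i)\in\mathrm{Inv}(\pi): p_{\pi_i}=j\}$. Then $\mathrm{disp}_{\mathrm{MVP}}(p)=\sum_{(j,i)\in S}(i-j)$.
   Context: Let $[n]=\{1,\dots,n\}$. A parking preference is $p\in[n]^n$. In the MVP parking process, cars $1,\dots,n$ enter in order a one-way street with spots $1,\dots,n$; car $i$ parks in spot $p_i$, and if $p_i$ was occupied by an earlier car $j$, car $j$ is bumped and parks in the first unoccupied spot $k>p_i$ (bumped cars do not bump others). $p$ is an MVP parking function if all cars park; $\mathrm{MVP}_n$ is the set of these. The outcome $\mathcal{O}_{\mathrm{MVP}_n}(p)$ is the permutation $\pi$ with $\pi_i$ the car in spot $i$ at the end. $\mathrm{Inv}(\pi)=\{(j,i):j<i,\ \pi_j>\pi_i\}$. The displacement of car $i$ is $|p_i-\pi^{ -1}_i|$ (distance between its preferred spot and its final spot), and $\mathrm{disp}_{\mathrm{MVP}}(p)$ is the sum of displacements of all cars. -}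

module Defs where

open import Data.Nat using (ℕ; _∸_; ∣_-_∣)
open import Data.Bool using (Bool; true; false; _∧_; if_then_else_)
open import Data.Fin using (Fin; toℕ; _<?_; _≟_)
open import Data.Fin.Permutation using (Permutation′; _⟨$⟩ʳ_; _⟨$⟩ˡ_)
open import Data.Maybe using (Maybe; just; nothing; _>>=_; is-nothing)
open import Data.Nat.ListAction using (sum)
open import Data.List using (List; []; _∷_; allFin; map; foldl; cartesianProduct; filter)
open import Data.Vec using (Vec; lookup; replicate; _[_]≔_)
open import Data.Product using (Σ; _×_; _,_)
open import Relation.Binary.PropositionalEquality using (_≡_)
open import Relation.Nullary using (does)
open import Relation.Nullary.Decidable using (_×-dec_)

-- Conventions: spots and cars are 0-indexed elements of Fin n
-- (spot/car k here is spot/car k+1 of the paper).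
-- A parking preference p ∈ [n]^n is a function Fin n → Fin n (car ↦ preferred spot).
Pref : ℕ → Set
Pref n = Fin n → Fin n

-- State of the street: spot ↦ the car parked there (if any).
Street : ℕ → Set
Street n = Vec (Maybe (Fin n)) n

emptyStreet : ∀ {n} → Street n
emptyStreet = replicate _ nothing

findFirst : ∀ {n} → (Fin n → Bool) → List (Fin n) → Maybe (Fin n)
findFirst f [] = nothing
findFirst f (x ∷ xs) = if f x then just x else findFirst f xs

firstEmptyAfter : ∀ {n} → Street n → Fin n → Maybe (Fin n)
firstEmptyAfter {n} st s =
  findFirst (λ k → does (s <? k) ∧ is-nothing (lookup st k)) (allFin n)

parkCar : ∀ {n} → Fin n → Fin n → Street n → Maybe (Street n)
parkCar i s st with lookup st s
... | nothing = just (st [ s ]≔ just i)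
... | just j with firstEmptyAfter st s
...   | nothing = nothing
...   | just k = just ((st [ s ]≔ just i) [ k ]≔ just j)

runMVP : ∀ {n} → Pref n → Maybe (Street n)
runMVP {n} p = foldl (λ m i → m >>= parkCar i (p i)) (just emptyStreet) (allFin n)

IsMVP : ∀ {n} → Pref n → Set
IsMVP {n} p = Σ (Street n) λ st → runMVP p ≡ just st

IsOutcome : ∀ {n} → Pref n → Permutation′ n → Set
IsOutcome {n} p π =
  Σ (Street n) λ st → (runMVP p ≡ just st) × (∀ i → lookup st i ≡ just (π ⟨$⟩ʳ i))

disp : ∀ {n} → Pref n → Permutation′ n → ℕ
disp {n} p π = sum (map (λ c → ∣ toℕ (p c) - toℕ (π ⟨$⟩ˡ c) ∣) (allFin n))

Inv : ∀ {n} → Permutation′ n → List (Fin n × Fin n)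
Inv {n} π = filter (λ { (j , i) → (j <? i) ×-dec ((π ⟨$⟩ʳ i) <? (π ⟨$⟩ʳ j)) })
                   (cartesianProduct (allFin n) (allFin n))

S : ∀ {n} → Pref n → Permutation′ n → List (Fin n × Fin n)
S p π = filter (λ { (j , i) → p (π ⟨$⟩ʳ i) ≟ j }) (Inv π)

sumS : ∀ {n} → Pref n → Permutation′ n → ℕ
sumS p π = sum (map (λ { (j , i) → toℕ i ∸ toℕ j }) (S p π))

-- Throughout the process, a car c parked in spot t satisfies p c ≤ t, and if p c < t then spot p c
-- holds a car that arrived after c: c was bumped from p c by a later car, and every later change at
-- p c only installs an even later car.  Hence in the outcome π, for the car π i in spot i we have
-- p (π i) ≤ i, and p (π i) < i forces (p (π i) , i) to be an inversion of π.  So the inversions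
-- counted by S are exactly the pairs (p (π i) , i) with p (π i) < i, and both sides equal
-- Σᵢ (i − p (π i)).
module Submission where

open import Defs
open import Algebra.Properties.CommutativeMonoid.Sum as FinSum using ()
open import Data.Bool using (Bool; true; false; T; if_then_else_)
open import Data.Bool.Properties using (T-∧; T-≡; if-eta)
open import Data.Empty using (⊥; ⊥-elim)
open import Data.Fin using (Fin; zero; suc; toℕ; _<?_; _≤_; _<_; punchIn)
open import Data.Fin.Permutation using (Permutation′; _⟨$⟩ʳ_; _⟨$⟩ˡ_; inverseˡ)
open import Data.Fin.Properties using (_≟_; ≤∧≢⇒<; punchInᵢ≢i)
open import Data.List using (List; []; _∷_; _++_; allFin; map; foldl; tabulate; filter; cartesianProduct)
open import Data.List.Properties using (map-tabulate; map-++; map-∘)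
open import Data.List.Relation.Unary.All as All using (All; []; _∷_)
open import Data.List.Relation.Unary.AllPairs using (AllPairs; []; _∷_)
open import Data.List.Relation.Unary.AllPairs.Properties using (tabulate⁺-<)
open import Data.Maybe using (Maybe; just; nothing; _>>=_; is-nothing)
open import Data.Maybe.Properties using (just-injective)
open import Data.Nat as ℕ using (ℕ; _+_; _∸_; ∣_-_∣)
open import Data.Nat.ListAction using (sum)
open import Data.Nat.ListAction.Properties using (sum-++)
open import Data.Nat.Properties as ℕ using (+-0-commutativeMonoid)
open import Data.Product using (∃; _×_; _,_; proj₁; proj₂)
open import Data.Sum using (_⊎_; inj₁; inj₂)
open import Data.Vec using (lookup; _[_]≔_)
open import Data.Vec.Properties using (lookup∘update; lookup∘update′; lookup-replicate)
open import Function using (id; _∘_; Equivalence)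
open import Level using (0ℓ)
open import Relation.Binary.PropositionalEquality
open import Relation.Nullary using (does; yes; no; contradiction)
open import Relation.Nullary.Decidable using (toWitness; isYes≗does; dec-true; dec-false; _×-dec_)
open import Relation.Unary using (Pred; Decidable)

open FinSum +-0-commutativeMonoid using (sum-syntax; ∑-comm; ∑-permute; sum-cong-≗; sum-remove; sum-replicate-zero)

findFirst-satisfies : ∀ {n} (f : Fin n → Bool) xs {k} → findFirst f xs ≡ just k → T (f k)
findFirst-satisfies f (x ∷ xs) found with f x in fx
... | true  = subst (T ∘ f) (just-injective found) (Equivalence.from T-≡ fx)
... | false = findFirst-satisfies f xs found

T-is-nothing : ∀ {A : Set} {m : Maybe A} → T (is-nothing m) → m ≡ nothing
T-is-nothing {m = nothing} _ = refl

firstEmptyAfter-sound : ∀ {n} (st : Street n) s {k} → firstEmptyAfter st s ≡ just k →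
                        s < k × lookup st k ≡ nothing
firstEmptyAfter-sound {n} st s {k} found
  with s<k , empty ← Equivalence.to T-∧ (findFirst-satisfies _ (allFin n) found)
  = toWitness (subst T (sym (isYes≗does (s <? k))) s<k) , T-is-nothing empty

-- All the invariant needs to know about car i parking at s via parkCar.
record Parks {n} (st : Street n) (i s : Fin n) (st′ : Street n) : Set where
  field
    parks  : lookup st′ s ≡ just i
    keeps  : ∀ {u d} → u ≢ s → lookup st u ≡ just d → lookup st′ u ≡ just d
    origin : ∀ {t c} → t ≢ s → lookup st′ t ≡ just c →
             lookup st t ≡ just c ⊎ (s < t × lookup st s ≡ just c)

parkCar-Parks : ∀ {n} (st : Street n) i s {st′} → parkCar i s st ≡ just st′ → Parks st i s st′
parkCar-Parks st i s parked with lookup st s in s-occupant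
parkCar-Parks st i s refl | nothing = record
  { parks  = lookup∘update s st (just i)
  ; keeps  = λ u≢s old → trans (lookup∘update′ u≢s st (just i)) old
  ; origin = λ t≢s new → inj₁ (trans (sym (lookup∘update′ t≢s st (just i))) new)
  }
parkCar-Parks st i s parked | just j with firstEmptyAfter st s in found
parkCar-Parks st i s refl | just j | just k = record
  { parks  = trans (lookup∘update′ s≢k st₁ (just j)) (lookup∘update s st (just i))
  ; keeps  = λ {u} u≢s old → trans (unchanged u≢s (occupied≢k old)) old
  ; origin = origin
  }
  where
  s<k = proj₁ (firstEmptyAfter-sound st s found)
  k-empty = proj₂ (firstEmptyAfter-sound st s found)
  st₁ = st [ s ]≔ just i

  s≢k : s ≢ k
  s≢k refl = ℕ.<-irrefl refl s<k

  occupied≢k : ∀ {u d} → lookup st u ≡ just d → u ≢ k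
  occupied≢k old refl with () ← trans (sym k-empty) old

  unchanged : ∀ {u} → u ≢ s → u ≢ k → lookup (st₁ [ k ]≔ just j) u ≡ lookup st u
  unchanged u≢s u≢k = trans (lookup∘update′ u≢k st₁ (just j)) (lookup∘update′ u≢s st (just i))

  origin : ∀ {t c} → t ≢ s → lookup (st₁ [ k ]≔ just j) t ≡ just c →
           lookup st t ≡ just c ⊎ (s < t × lookup st s ≡ just c)
  origin {t} t≢s new with t ≟ k
  ... | yes refl = inj₂ (s<k , trans s-occupant (trans (sym (lookup∘update t st₁ (just j))) new))
  ... | no t≢k   = inj₁ (trans (sym (unchanged t≢s t≢k)) new)

module _ {n : ℕ} where

  ParkedBefore : Street n → Fin n → Set
  ParkedBefore st x = ∀ {t c} → lookup st t ≡ just c → c < x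

  OccupantsGrow : Street n → Street n → Set
  OccupantsGrow st st′ = ∀ {u d} → lookup st u ≡ just d → ∃ λ d′ → lookup st′ u ≡ just d′ × d ≤ d′

  emptyStreet-vacant : ∀ {t c} → lookup (emptyStreet {n}) t ≡ just c → ⊥
  emptyStreet-vacant {t} occupied with () ← trans (sym (lookup-replicate t nothing)) occupied

  emptyStreet-ParkedBefore : ∀ x → ParkedBefore emptyStreet x
  emptyStreet-ParkedBefore _ occupied = ⊥-elim (emptyStreet-vacant occupied)

  module _ {st st′ : Street n} {x s : Fin n} (step : Parks st x s st′) where
    open Parks step

    parked-at-s : ∀ {c} → lookup st′ s ≡ just c → c ≡ x
    parked-at-s new = just-injective (trans (sym new) parks)

    Parks-OccupantsGrow : ParkedBefore st x → OccupantsGrow st st′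
    Parks-OccupantsGrow before {u} old with u ≟ s
    ... | yes refl = x , parks , ℕ.<⇒≤ (before old)
    ... | no u≢s   = _ , keeps u≢s old , ℕ.≤-refl

    Parks-ParkedBefore : ∀ {y} → ParkedBefore st y → x < y → ParkedBefore st′ y
    Parks-ParkedBefore before x<y {t} new with t ≟ s
    ... | yes refl = subst (_< _) (sym (parked-at-s new)) x<y
    ... | no t≢s with origin t≢s new
    ...   | inj₁ old       = before old
    ...   | inj₂ (_ , old) = before old

    Parks-AllParkedBefore : ∀ {ys} → All (ParkedBefore st) ys → All (x <_) ys → All (ParkedBefore st′) ys
    Parks-AllParkedBefore []                  []           = []
    Parks-AllParkedBefore (before ∷ befores) (x<y ∷ x<ys) =
      Parks-ParkedBefore before x<y ∷ Parks-AllParkedBefore befores x<ys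

module _ {n : ℕ} (p : Pref n) where

  WellPlaced : Street n → Fin n → Fin n → Set
  WellPlaced st t c = p c ≤ t × (p c < t → ∃ λ d → lookup st (p c) ≡ just d × c < d)

  AllWellPlaced : Street n → Set
  AllWellPlaced st = ∀ {t c} → lookup st t ≡ just c → WellPlaced st t c

  WellPlaced-preferred : ∀ {st} c → WellPlaced st (p c) c
  WellPlaced-preferred c = ℕ.≤-refl , λ pc<pc → contradiction pc<pc (ℕ.<-irrefl refl)

  WellPlaced-grow : ∀ {st st′ t c} → OccupantsGrow st st′ → WellPlaced st t c → WellPlaced st′ t c
  WellPlaced-grow {st′ = st′} {t} {c} grow (pc≤t , bumped) = pc≤t , later
    where
    later : p c < t → ∃ λ d → lookup st′ (p c) ≡ just d × c < d
    later pc<t with d , old , c<d ← bumped pc<t with d′ , new , d≤d′ ← grow old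
      = d′ , new , ℕ.<-≤-trans c<d d≤d′

  -- The step for a bumped car: it was well placed in s, from which the later car x bumped it.
  WellPlaced-forward : ∀ {st s t c x} → lookup st s ≡ just x → c < x → s < t →
                       WellPlaced st s c → WellPlaced st t c
  WellPlaced-forward {st} {s} {t} {c} {x} occupant c<x s<t (pc≤s , bumped) =
    ℕ.≤-trans pc≤s (ℕ.<⇒≤ s<t) , later
    where
    later : p c < t → ∃ λ d → lookup st (p c) ≡ just d × c < d
    later _ with p c ≟ s
    ... | yes refl = x , occupant , c<x
    ... | no pc≢s  = bumped (≤∧≢⇒< pc≤s pc≢s)

  Parks-AllWellPlaced : ∀ {st st′ x} → Parks st x (p x) st′ → ParkedBefore st x →
                        AllWellPlaced st → AllWellPlaced st′
  Parks-AllWellPlaced {st} {st′} {x} step before wellPlaced {t} new with t ≟ p x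
  ... | yes refl rewrite parked-at-s step new = WellPlaced-preferred {st′} x
  ... | no t≢s with Parks.origin step t≢s new
  ...   | inj₁ old         = WellPlaced-grow {st} {st′} (Parks-OccupantsGrow step before) (wellPlaced old)
  ...   | inj₂ (s<t , old) = WellPlaced-forward {st′} (Parks.parks step) (before old) s<t
                               (WellPlaced-grow {st} {st′} (Parks-OccupantsGrow step before) (wellPlaced old))

  parkNext : Maybe (Street n) → Fin n → Maybe (Street n)
  parkNext m i = m >>= parkCar i (p i)

  foldl-parkNext-nothing : ∀ xs → foldl parkNext nothing xs ≡ nothing
  foldl-parkNext-nothing []       = refl
  foldl-parkNext-nothing (_ ∷ xs) = foldl-parkNext-nothing xs

  foldl-parkNext-AllWellPlaced : ∀ {st st′} xs → AllPairs _<_ xs → All (ParkedBefore st) xs →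
                                 AllWellPlaced st → foldl parkNext (just st) xs ≡ just st′ →
                                 AllWellPlaced st′
  foldl-parkNext-AllWellPlaced [] _ _ wellPlaced refl = wellPlaced
  foldl-parkNext-AllWellPlaced {st} (x ∷ xs) (x<xs ∷ sorted) (before ∷ befores) wellPlaced run
    with parkCar x (p x) st in parked
  ... | nothing  with () ← trans (sym (foldl-parkNext-nothing xs)) run
  ... | just st₁ = foldl-parkNext-AllWellPlaced xs sorted
                     (Parks-AllParkedBefore step befores x<xs)
                     (Parks-AllWellPlaced step before wellPlaced) run
    where step = parkCar-Parks st x (p x) parked

  runMVP-AllWellPlaced : ∀ {st} → runMVP p ≡ just st → AllWellPlaced st
  runMVP-AllWellPlaced =
    foldl-parkNext-AllWellPlaced (allFin n) (tabulate⁺-< id)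
      (All.universal emptyStreet-ParkedBefore (allFin n)) (λ occupied → ⊥-elim (emptyStreet-vacant occupied))

sum-tabulate : ∀ {k} (f : Fin k → ℕ) → sum (tabulate f) ≡ ∑[ i < k ] f i
sum-tabulate {ℕ.zero}  f = refl
sum-tabulate {ℕ.suc k} f = cong (f zero +_) (sum-tabulate (f ∘ suc))

sum-map-allFin : ∀ {k} (f : Fin k → ℕ) → sum (map f (allFin k)) ≡ ∑[ i < k ] f i
sum-map-allFin f = trans (cong sum (map-tabulate id f)) (sum-tabulate f)

sum-map-filter : ∀ {A : Set} {P : Pred A 0ℓ} (P? : Decidable P) (f : A → ℕ) xs →
                 sum (map f (filter P? xs)) ≡ sum (map (λ x → if does (P? x) then f x else 0) xs)
sum-map-filter P? f []       = refl
sum-map-filter P? f (x ∷ xs) with does (P? x)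
... | true  = cong (f x +_) (sum-map-filter P? f xs)
... | false = sum-map-filter P? f xs

sum-map-cartesianProduct : ∀ {A B : Set} (f : A × B → ℕ) xs (ys : List B) →
                           sum (map f (cartesianProduct xs ys)) ≡
                           sum (map (λ x → sum (map (λ y → f (x , y)) ys)) xs)
sum-map-cartesianProduct f []       ys = refl
sum-map-cartesianProduct f (x ∷ xs) ys = begin
  sum (map f (map (x ,_) ys ++ cartesianProduct xs ys))
    ≡⟨ cong sum (map-++ f (map (x ,_) ys) _) ⟩
  sum (map f (map (x ,_) ys) ++ map f (cartesianProduct xs ys))
    ≡⟨ sum-++ (map f (map (x ,_) ys)) _ ⟩
  sum (map f (map (x ,_) ys)) + sum (map f (cartesianProduct xs ys))
    ≡⟨ cong₂ _+_ (cong sum (sym (map-∘ ys))) (sum-map-cartesianProduct f xs ys) ⟩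
  sum (map (f ∘ (x ,_)) ys) + sum (map (λ x → sum (map (λ y → f (x , y)) ys)) xs)
    ∎
  where open ≡-Reasoning

sum-eq-single : ∀ {k} (f : Fin k → ℕ) i → (∀ j → j ≢ i → f j ≡ 0) → ∑[ j < k ] f j ≡ f i
sum-eq-single {ℕ.suc k} f i f≡0 = begin
  ∑[ j < ℕ.suc k ] f j                  ≡⟨ sum-remove {i = i} f ⟩
  f i + ∑[ j < k ] f (punchIn i j)      ≡⟨ cong (f i +_) (sum-cong-≗ (λ j → f≡0 _ (punchInᵢ≢i i j))) ⟩
  f i + ∑[ j < k ] 0                    ≡⟨ cong (f i +_) (sum-replicate-zero k) ⟩
  f i + 0                               ≡⟨ ℕ.+-identityʳ (f i) ⟩
  f i                                   ∎
  where open ≡-Reasoning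

module _ {n : ℕ} (p : Pref n) (π : Permutation′ n) where

  preferenceAt : Fin n → Fin n
  preferenceAt i = p (π ⟨$⟩ʳ i)

  disp≡∑spot∸preference : (∀ i → preferenceAt i ≤ i) →
                          disp p π ≡ ∑[ i < n ] (toℕ i ∸ toℕ (preferenceAt i))
  disp≡∑spot∸preference preference≤spot = begin
    disp p π                              ≡⟨ sum-map-allFin displacement ⟩
    ∑[ c < n ] displacement c             ≡⟨ ∑-permute displacement π ⟩
    ∑[ i < n ] displacement (π ⟨$⟩ʳ i)    ≡⟨ sum-cong-≗ displacement-at ⟩
    ∑[ i < n ] (toℕ i ∸ toℕ (preferenceAt i)) ∎
    where
    open ≡-Reasoning
    displacement : Fin n → ℕ
    displacement c = ∣ toℕ (p c) - toℕ (π ⟨$⟩ˡ c) ∣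

    displacement-at : ∀ i → displacement (π ⟨$⟩ʳ i) ≡ toℕ i ∸ toℕ (preferenceAt i)
    displacement-at i rewrite inverseˡ π {i} = ℕ.m≤n⇒∣m-n∣≡n∸m (preference≤spot i)

  inversionTerm : Fin n → Fin n → ℕ
  inversionTerm j i =
    if does ((j <? i) ×-dec (π ⟨$⟩ʳ i <? π ⟨$⟩ʳ j))
    then (if does (preferenceAt i ≟ j) then toℕ i ∸ toℕ j else 0)
    else 0

  sumS≡∑∑inversionTerm : sumS p π ≡ ∑[ j < n ] ∑[ i < n ] inversionTerm j i
  sumS≡∑∑inversionTerm = begin
    sumS p π
      ≡⟨ sum-map-filter preferred? (λ (j , i) → toℕ i ∸ toℕ j) (filter inversion? pairs) ⟩
    sum (map (λ (j , i) → if does (preferenceAt i ≟ j) then toℕ i ∸ toℕ j else 0) (filter inversion? pairs))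
      ≡⟨ sum-map-filter inversion? _ pairs ⟩
    sum (map (λ (j , i) → inversionTerm j i) pairs)
      ≡⟨ sum-map-cartesianProduct (λ (j , i) → inversionTerm j i) (allFin n) (allFin n) ⟩
    sum (map (λ j → sum (map (inversionTerm j) (allFin n))) (allFin n))
      ≡⟨ sum-map-allFin (λ j → sum (map (inversionTerm j) (allFin n))) ⟩
    ∑[ j < n ] sum (map (inversionTerm j) (allFin n))
      ≡⟨ sum-cong-≗ (λ j → sum-map-allFin (inversionTerm j)) ⟩
    ∑[ j < n ] ∑[ i < n ] inversionTerm j i
      ∎
    where
    open ≡-Reasoning
    pairs = cartesianProduct (allFin n) (allFin n)

    inversion? : Decidable {A = Fin n × Fin n} λ (j , i) → j < i × π ⟨$⟩ʳ i < π ⟨$⟩ʳ j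
    inversion? (j , i) = (j <? i) ×-dec (π ⟨$⟩ʳ i <? π ⟨$⟩ʳ j)

    preferred? : Decidable {A = Fin n × Fin n} λ (j , i) → preferenceAt i ≡ j
    preferred? (j , i) = preferenceAt i ≟ j

  inversionTerm-off : ∀ {j i} → j ≢ preferenceAt i → inversionTerm j i ≡ 0
  inversionTerm-off {j} {i} j≢preference rewrite dec-false (preferenceAt i ≟ j) (j≢preference ∘ sym) =
    if-eta _

  inversionTerm-on : ∀ i → (preferenceAt i < i → π ⟨$⟩ʳ i < π ⟨$⟩ʳ preferenceAt i) →
                     inversionTerm (preferenceAt i) i ≡ toℕ i ∸ toℕ (preferenceAt i)
  inversionTerm-on i inverted rewrite dec-true (preferenceAt i ≟ preferenceAt i) refl
    with preferenceAt i <? i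
  ... | yes before
    rewrite dec-true ((preferenceAt i <? i) ×-dec (π ⟨$⟩ʳ i <? π ⟨$⟩ʳ preferenceAt i)) (before , inverted before)
    = refl
  -- No inversion means p (π i) ≥ i, where the truncated difference i ∸ p (π i) is 0 as well.
  ... | no notBefore rewrite ℕ.m≤n⇒m∸n≡0 (ℕ.≮⇒≥ notBefore) = if-eta _

  sumS≡∑spot∸preference : (∀ i → preferenceAt i < i → π ⟨$⟩ʳ i < π ⟨$⟩ʳ preferenceAt i) →
                          sumS p π ≡ ∑[ i < n ] (toℕ i ∸ toℕ (preferenceAt i))
  sumS≡∑spot∸preference inverted = begin
    sumS p π                                  ≡⟨ sumS≡∑∑inversionTerm ⟩
    ∑[ j < n ] ∑[ i < n ] inversionTerm j i   ≡⟨ ∑-comm inversionTerm ⟩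
    ∑[ i < n ] ∑[ j < n ] inversionTerm j i   ≡⟨ sum-cong-≗ (λ i → sum-eq-single (λ j → inversionTerm j i)
                                                                             (preferenceAt i) (λ _ → inversionTerm-off)) ⟩
    ∑[ i < n ] inversionTerm (preferenceAt i) i ≡⟨ sum-cong-≗ (λ i → inversionTerm-on i (inverted i)) ⟩
    ∑[ i < n ] (toℕ i ∸ toℕ (preferenceAt i)) ∎
    where open ≡-Reasoning

proposition2p11 : (n : ℕ) (p : Pref n) → IsMVP p → (π : Permutation′ n) → IsOutcome p π →
    disp p π ≡ sumS p π
-- IsMVP p is unused: it is implied by IsOutcome p π.
proposition2p11 n p _ π (st , run , occupant) = begin
  disp p π                                    ≡⟨ disp≡∑spot∸preference p π (proj₁ ∘ wellPlaced) ⟩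
  ∑[ i < n ] (toℕ i ∸ toℕ (preferenceAt p π i)) ≡⟨ sumS≡∑spot∸preference p π inverted ⟨
  sumS p π                                    ∎
  where
  open ≡-Reasoning
  wellPlaced : ∀ i → WellPlaced p st i (π ⟨$⟩ʳ i)
  wellPlaced i = runMVP-AllWellPlaced p run (occupant i)

  inverted : ∀ i → preferenceAt p π i < i → π ⟨$⟩ʳ i < π ⟨$⟩ʳ preferenceAt p π i
  inverted i bumped with d , occupied , later ← proj₂ (wellPlaced i) bumped
    rewrite just-injective (trans (sym occupied) (occupant (preferenceAt p π i))) = later
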